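{- If $\mathcal{A}$ is a path object and $P(x)$ is a proposition for each $x:|\mathcal{A}|$, then the comprehension $\{x:\mathcal{A}\mid P(x)\}$ is a path object.
   Context: Intensional Martin-Löf type theory with $\Pi,\Sigma$, identity types. A reflexive graph $\mathcal{G}$: type $|\mathcal{G}|$, edge types $x\approx_{\mathcal{G}}y$, $\mathsf{rx}_{\mathcal{G}}(x):x\approx_{\mathcal{G}}x$; a path object if every fan $\sum_yx\approx_{\mathcal{G}}y$ is a proposition. The comprehension $\{x:\mathcal{A}\mid P(x)\}$ is the reflexive graph with vertices $\sum_{x:|\mathcal{A}|}P(x)$, edges $(x,h)\approx(y,k):=x\approx_{\mathcal{A}}y$, and reflexivity $\mathsf{rx}_{\mathcal{A}}(x)$. -}

{-# OPTIONS --without-K #-}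
module Defs where

open import Level using (Level; _⊔_; suc)
open import Data.Product using (Σ; _,_)
open import Relation.Binary.PropositionalEquality using (_≡_)

isProp : {ℓ : Level} → Set ℓ → Set ℓ
isProp A = (a b : A) → a ≡ b

record RGraph (ℓv ℓe : Level) : Set (suc (ℓv ⊔ ℓe)) where
  field
    V   : Set ℓv
    _≈_ : V → V → Set ℓe
    rx  : (x : V) → x ≈ x
open RGraph public

isPathObject : {ℓv ℓe : Level} → RGraph ℓv ℓe → Set (ℓv ⊔ ℓe)
isPathObject 𝒢 = (x : V 𝒢) → isProp (Σ (V 𝒢) (λ y → _≈_ 𝒢 x y))

comprehension : {ℓv ℓe ℓp : Level} (𝒜 : RGraph ℓv ℓe) → (V 𝒜 → Set ℓp)
              → RGraph (ℓv ⊔ ℓp) ℓe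
comprehension 𝒜 P = record
  { V   = Σ (V 𝒜) P
  ; _≈_ = λ { (x , h) (y , k) → _≈_ 𝒜 x y }
  ; rx  = λ { (x , h) → rx 𝒜 x }
  }

{-# OPTIONS --without-K #-}
module Submission where

open import Defs
open import Level using (Level; _⊔_)
open import Data.Product using (Σ; _,_)
open import Relation.Binary.PropositionalEquality using (_≡_; refl; cong; sym; module ≡-Reasoning)

-- The fan of the comprehension at (x , h) is a retract of the fan of 𝒜 at x
-- with a proof of P attached to the endpoint, and a Σ of propositions over a
-- proposition is again a proposition.

Σ-isProp : {a b : Level} {A : Set a} {B : A → Set b}
  → isProp A → ((x : A) → isProp (B x)) → isProp (Σ A B)
Σ-isProp pA pB (x , u) (y , v) with pA x y
... | refl = cong (x ,_) (pB x u v)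

isProp-retract : {a b : Level} {A : Set a} {B : Set b}
  (f : A → B) (g : B → A) → ((y : B) → f (g y) ≡ y) → isProp A → isProp B
isProp-retract f g fg pA y y′ = begin
  y         ≡⟨ sym (fg y) ⟩
  f (g y)   ≡⟨ cong f (pA (g y) (g y′)) ⟩
  f (g y′)  ≡⟨ fg y′ ⟩
  y′        ∎
  where open ≡-Reasoning

module _ {ℓv ℓe ℓp : Level} (𝒜 : RGraph ℓv ℓe) (P : V 𝒜 → Set ℓp) where

  Fan : V 𝒜 → Set (ℓv ⊔ ℓe)
  Fan x = Σ (V 𝒜) (_≈_ 𝒜 x)

  comprehension-fan : (x : V 𝒜) → P x → Set (ℓv ⊔ ℓe ⊔ ℓp)
  comprehension-fan x h = Σ (V (comprehension 𝒜 P)) (_≈_ (comprehension 𝒜 P) (x , h))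

  fan-with-P→comprehension-fan : {x : V 𝒜} {h : P x}
    → Σ (Fan x) (λ (y , _) → P y) → comprehension-fan x h
  fan-with-P→comprehension-fan ((y , e) , k) = (y , k) , e

  comprehension-fan→fan-with-P : {x : V 𝒜} {h : P x}
    → comprehension-fan x h → Σ (Fan x) (λ (y , _) → P y)
  comprehension-fan→fan-with-P ((y , k) , e) = (y , e) , k

mainTheorem16 : {ℓv ℓe ℓp : Level} (𝒜 : RGraph ℓv ℓe) (P : V 𝒜 → Set ℓp)
    → isPathObject 𝒜 → ((x : V 𝒜) → isProp (P x))
    → isPathObject (comprehension 𝒜 P)
mainTheorem16 𝒜 P 𝒜-path P-prop (x , h) =
  isProp-retract
    (fan-with-P→comprehension-fan 𝒜 P {h = h})
    (comprehension-fan→fan-with-P 𝒜 P {h = h})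
    (λ _ → refl)
    (Σ-isProp (𝒜-path x) (λ (y , _) → P-prop y))
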